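{- For every $k \in \mathbb{N}_0$, the set $F(\chi,k)$ of minimal forbidden induced subgraphs of $\varUpsilon_k$ is finite (up to isomorphism).
   Context: All graphs are finite and simple. $\Delta(H)$ denotes the maximum degree, $\chi(H)$ the chromatic number of $H$. For $k\in\mathbb{N}_0$, $\varUpsilon_k$ is the class of graphs $G$ such that every induced subgraph $H$ of $G$ (including $G$ itself) satisfies $\Delta(H)\le \chi(H)+k-1$. $F(\chi,k)$ denotes the set of minimal forbidden induced subgraphs of $\varUpsilon_k$: $F\in F(\chi,k)$ iff $F\notin\varUpsilon_k$ and every proper induced subgraph of $F$ lies in $\varUpsilon_k$. -}

module Defs where

open import Data.Nat using (ℕ; zero; suc; _+_; _≤_; _<_; _⊔_)
open import Data.Fin using (Fin)
open import Data.Bool using (Bool; true; false; if_then_else_)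
open import Data.List using (List; map; foldr; allFin)
open import Data.Nat.ListAction using (sum)
open import Data.Product using (Σ; _×_; ∃; ∃-syntax)
open import Relation.Binary.PropositionalEquality using (_≡_; _≢_)
open import Relation.Nullary using (¬_)
open import Function.Definitions using (Injective)
open import Function.Bundles using (_↔_; Inverse)

record Graph (n : ℕ) : Set where
  field
    adj   : Fin n → Fin n → Bool
    sym   : ∀ i j → adj i j ≡ adj j i
    irrefl : ∀ i → adj i i ≡ false
open Graph public

-- Degree of a vertex and maximum degree Δ (Δ of the null graph is 0).
deg : ∀ {n} → Graph n → Fin n → ℕ
deg {n} G v = sum (map (λ u → if adj G v u then 1 else 0) (allFin n))

Δ : ∀ {n} → Graph n → ℕ
Δ {n} G = foldr _⊔_ 0 (map (deg G) (allFin n))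

Colourable : ∀ {n} → Graph n → ℕ → Set
Colourable {n} G c =
  Σ (Fin n → Fin c) λ f → ∀ i j → adj G i j ≡ true → f i ≢ f j

IsChromaticNumber : ∀ {n} → Graph n → ℕ → Set
IsChromaticNumber G c = Colourable G c × (∀ d → d < c → ¬ Colourable G d)

InducedSub : ∀ {m n} → Graph m → Graph n → Set
InducedSub {m} {n} H G =
  Σ (Fin m → Fin n) λ f → Injective _≡_ _≡_ f × (∀ i j → adj H i j ≡ adj G (f i) (f j))

Iso : ∀ {m n} → Graph m → Graph n → Set
Iso {m} {n} G H =
  Σ (Fin m ↔ Fin n) λ φ → ∀ i j → adj G i j ≡ adj H (Inverse.to φ i) (Inverse.to φ j)

-- Δ(H) ≤ χ(H) + k - 1, written without truncated subtraction.
DegCond : ℕ → ∀ {m} → Graph m → Set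
DegCond k H = ∀ c → IsChromaticNumber H c → Δ H + 1 ≤ c + k

Upsilon : ℕ → ∀ {n} → Graph n → Set
Upsilon k G = ∀ m (H : Graph m) → 1 ≤ m → InducedSub H G → DegCond k H

MinForbidden : ℕ → ∀ {n} → Graph n → Set
MinForbidden k {n} F =
  ¬ Upsilon k F × (∀ m (H : Graph m) → m < n → InducedSub H F → Upsilon k H)

SomeGraph : Set
SomeGraph = Σ ℕ Graph

module Submission where

-- Let H have 1+m vertices,
-- chromatic number c = 1+c₀ with Δ(H) ≥ c+k, while every vertex-deleted subgraph H-u
-- satisfies Δ(H-u) ≤ χ(H-u)+k-1 ≤ c+k-1.  Fix a vertex v of maximum degree.  For u ≠ v
-- we have Δ(H) ≤ [uv ∈ E] + Δ(H-u), which forces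
--   (1) v is adjacent to every other vertex, so Δ(H) = deg v = m;
--   (2) Δ(H) ≤ c+k, so m ≤ c+k;
--   (3) no u ≠ v is alone in its colour class (else H-u would be c₀-colourable).
-- As v is alone in its class and every colour is used, 1+2c₀ ≤ 1+m; together with (2)
-- this gives 1+m ≤ 2k+3.  Hence a graph with more than 2k+3 vertices whose proper
-- induced subgraphs all lie in Υ_k lies in Υ_k itself, so minimal forbidden graphs are
-- small, and an explicit list of all graphs with at most 2k+3 vertices contains them.

open import Defs hiding (sym)
open import Data.Nat using (ℕ; zero; suc; _+_; _≤_; _<_; _⊔_; z≤n; s≤s; _≤?_; _<?_)
open import Data.Nat.Properties hiding (_≟_)
open import Data.Fin using (Fin; zero; suc; punchIn; punchOut; splitAt; join; inject≤; fromℕ<; _≟_)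
open import Data.Fin.Properties
  using (punchIn-injective; punchInᵢ≢i; punchIn-punchOut; punchOut-injective;
         inject≤-injective; join-splitAt; injective⇒≤; any?; ¬Fin0)
open import Data.Bool using (Bool; true; false; if_then_else_)
open import Data.List using (List; []; _∷_; _++_; map; foldr; tabulate; cartesianProductWith)
open import Data.List.Relation.Unary.Any using (Any; here; there)
import Data.List.Relation.Unary.Any as Any
open import Data.List.Relation.Unary.Any.Properties using (map⁺; ++⁺ˡ; ++⁺ʳ; cartesianProductWith⁺)
open import Data.Vec.Functional as Vector using (Vector)
open import Algebra.Properties.CommutativeMonoid.Sum +-0-commutativeMonoid
  using (sum-remove) renaming (sum to ∑)
open import Data.Product using (_×_; _,_; ∃-syntax; ∃₂; proj₁; proj₂)
open import Data.Sum using (_⊎_; inj₁; inj₂; [_,_]′)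
open import Data.Empty using (⊥-elim)
open import Relation.Nullary using (¬_; yes; no; ¬?)
open import Relation.Nullary.Decidable using (decidable-stable; ¬¬-excluded-middle; _×-dec_)
open import Relation.Binary.PropositionalEquality
  using (_≡_; _≢_; refl; sym; trans; cong; cong₂; subst; module ≡-Reasoning)
open import Function using (_∘_; id)
open import Function.Construct.Identity using (↔-id)

-- Folding a list produced by `tabulate` is folding the underlying vector; this
-- transports the list-based `deg` and `Δ` of Defs to vectors indexed by Fin n.
foldr-map-tabulate : ∀ {A : Set} (_∙_ : ℕ → ℕ → ℕ) e {n} (g : A → ℕ) (h : Fin n → A) →
  foldr _∙_ e (map g (tabulate h)) ≡ Vector.foldr _∙_ e (g ∘ h)
foldr-map-tabulate _∙_ e {zero}  g h = refl
foldr-map-tabulate _∙_ e {suc n} g h = cong (g (h zero) ∙_) (foldr-map-tabulate _∙_ e g (h ∘ suc))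

max : ∀ {n} → Vector ℕ n → ℕ
max = Vector.foldr _⊔_ 0

≤-max : ∀ {n} (t : Vector ℕ n) i → t i ≤ max t
≤-max t zero    = m≤m⊔n (t zero) _
≤-max t (suc i) = ≤-trans (≤-max (t ∘ suc) i) (m≤n⊔m (t zero) _)

max-attained : ∀ {n} (t : Vector ℕ (suc n)) → ∃[ i ] t i ≡ max t
max-attained {zero} t = zero , sym (⊔-identityʳ (t zero))
max-attained {suc n} t with ⊔-sel (t zero) (max (t ∘ suc))
... | inj₁ first≡max = zero , sym first≡max
... | inj₂ rest≡max with max-attained (t ∘ suc)
...   | i , tᵢ≡max = suc i , trans tᵢ≡max (sym rest≡max)

∑-ones : ∀ {m} (t : Vector ℕ m) → (∀ i → t i ≡ 1) → ∑ t ≡ m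
∑-ones {zero}  t ones = refl
∑-ones {suc m} t ones = cong₂ _+_ (ones zero) (∑-ones (t ∘ suc) (ones ∘ suc))

indicator : Bool → ℕ
indicator b = if b then 1 else 0

indicator≤1 : ∀ b → indicator b ≤ 1
indicator≤1 true  = ≤-refl
indicator≤1 false = z≤n

deg-sum : ∀ {n} (G : Graph n) v → deg G v ≡ ∑ (λ u → indicator (adj G v u))
deg-sum G v = foldr-map-tabulate _+_ 0 (λ u → indicator (adj G v u)) id

Δ-max : ∀ {n} (G : Graph n) → Δ G ≡ max (deg G)
Δ-max G = foldr-map-tabulate _⊔_ 0 (deg G) id

deg≤Δ : ∀ {n} (G : Graph n) v → deg G v ≤ Δ G
deg≤Δ G v = subst (deg G v ≤_) (sym (Δ-max G)) (≤-max (deg G) v)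

Δ-attained : ∀ {m} (G : Graph (suc m)) → ∃[ v ] deg G v ≡ Δ G
Δ-attained G with max-attained (deg G)
... | v , degᵥ≡max = v , trans degᵥ≡max (sym (Δ-max G))

-- The graph G - u obtained by deleting vertex u; its vertex w is the vertex punchIn u w of G.
delete : ∀ {m} → Graph (suc m) → Fin (suc m) → Graph m
delete G u = record
  { adj    = λ i j → adj G (punchIn u i) (punchIn u j)
  ; sym    = λ i j → Graph.sym G (punchIn u i) (punchIn u j)
  ; irrefl = λ i → irrefl G (punchIn u i)
  }

deg-delete : ∀ {m} (G : Graph (suc m)) u w →
  deg G (punchIn u w) ≡ indicator (adj G (punchIn u w) u) + deg (delete G u) w
deg-delete G u w = begin
  deg G (punchIn u w)
    ≡⟨ deg-sum G (punchIn u w) ⟩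
  ∑ neighbours
    ≡⟨ sum-remove {i = u} neighbours ⟩
  neighbours u + ∑ (neighbours ∘ punchIn u)
    ≡⟨ cong (neighbours u +_) (sym (deg-sum (delete G u) w)) ⟩
  indicator (adj G (punchIn u w) u) + deg (delete G u) w
    ∎
  where
  open ≡-Reasoning
  neighbours : Vector ℕ (suc _)
  neighbours x = indicator (adj G (punchIn u w) x)

deg-universal : ∀ {m} (G : Graph (suc m)) v → (∀ u → u ≢ v → adj G v u ≡ true) → deg G v ≡ m
deg-universal {m} G v universal = begin
  deg G v
    ≡⟨ deg-sum G v ⟩
  ∑ neighbours
    ≡⟨ sum-remove {i = v} neighbours ⟩
  neighbours v + ∑ (neighbours ∘ punchIn v)
    ≡⟨ cong (λ b → indicator b + ∑ (neighbours ∘ punchIn v)) (irrefl G v) ⟩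
  ∑ (neighbours ∘ punchIn v)
    ≡⟨ ∑-ones (neighbours ∘ punchIn v) (λ i → cong indicator (universal _ (punchInᵢ≢i v i))) ⟩
  m
    ∎
  where
  open ≡-Reasoning
  neighbours : Vector ℕ (suc m)
  neighbours x = indicator (adj G v x)

Δ-delete : ∀ {m} (G : Graph (suc m)) {v u} → deg G v ≡ Δ G → (u≢v : u ≢ v) →
  Δ G ≤ indicator (adj G v u) + Δ (delete G u)
Δ-delete {m} G {v} {u} degᵥ≡Δ u≢v = begin
  Δ G
    ≡⟨ sym degᵥ≡Δ ⟩
  deg G v
    ≡⟨ cong (deg G) (sym w↦v) ⟩
  deg G (punchIn u w)
    ≡⟨ deg-delete G u w ⟩
  indicator (adj G (punchIn u w) u) + deg (delete G u) w
    ≡⟨ cong (λ x → indicator (adj G x u) + deg (delete G u) w) w↦v ⟩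
  indicator (adj G v u) + deg (delete G u) w
    ≤⟨ +-monoʳ-≤ (indicator (adj G v u)) (deg≤Δ (delete G u) w) ⟩
  indicator (adj G v u) + Δ (delete G u)
    ∎
  where
  open ≤-Reasoning
  w : Fin m
  w = punchOut u≢v
  w↦v : punchIn u w ≡ v
  w↦v = punchIn-punchOut u≢v

delete-induced : ∀ {m} (G : Graph (suc m)) u → InducedSub (delete G u) G
delete-induced G u = punchIn u , punchIn-injective u _ _ , λ i j → refl

induced-refl : ∀ {n} (G : Graph n) → InducedSub G G
induced-refl G = id , id , λ i j → refl

induced-trans : ∀ {a b c} {A : Graph a} {B : Graph b} {C : Graph c} →
  InducedSub A B → InducedSub B C → InducedSub A C
induced-trans (f , f-inj , f-adj) (g , g-inj , g-adj) =
  g ∘ f , f-inj ∘ g-inj , λ i j → trans (f-adj i j) (g-adj (f i) (f j))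

induced-size : ∀ {m n} {H : Graph m} {G : Graph n} → InducedSub H G → m ≤ n
induced-size (f , f-inj , _) = injective⇒≤ f-inj

restrict : ∀ {a b} {A : Graph a} {B : Graph b} {c} → InducedSub A B → Colourable B c → Colourable A c
restrict (f , _ , f-adj) (col , proper) =
  col ∘ f , λ i j i~j → proper (f i) (f j) (trans (sym (f-adj i j)) i~j)

weaken : ∀ {n} {G : Graph n} {c d} → c ≤ d → Colourable G c → Colourable G d
weaken c≤d (col , proper) =
  (λ i → inject≤ (col i) c≤d) , λ i j i~j → proper i j i~j ∘ inject≤-injective c≤d c≤d _ _

dropColour : ∀ {n} (G : Graph n) {c} (col : Fin n → Fin (suc c)) →
  (∀ i j → adj G i j ≡ true → col i ≢ col j) → (x : Fin (suc c)) → (∀ i → x ≢ col i) →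
  Colourable G c
dropColour G col proper x missed =
  (λ i → punchOut (missed i)) , λ i j i~j → proper i j i~j ∘ punchOut-injective (missed i) (missed j)

-- A c-colourable graph has a chromatic number at most c.  Colourability is not decided
-- here, so the witness is obtained only in double-negated form.
chromaticNumber-exists : ∀ {n} (G : Graph n) c → Colourable G c →
  ¬ ¬ (∃[ χ ] IsChromaticNumber G χ × χ ≤ c)
chromaticNumber-exists G zero col noχ = noχ (0 , (col , λ d ()) , ≤-refl)
chromaticNumber-exists G (suc c) col noχ = ¬¬-excluded-middle λ where
  (yes col′) → chromaticNumber-exists G c col′ λ (χ , isχ , χ≤c) → noχ (χ , isχ , m≤n⇒m≤1+n χ≤c)
  (no ¬col′) → noχ (suc c , (col , λ d d<1+c → ¬col′ ∘ weaken {G = G} (≤-pred d<1+c)) , ≤-refl)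

-- The degree condition bounds Δ by any number of colours that suffices: since ≤ is
-- decidable, the double-negated chromatic number is enough.
degCond-colourable : ∀ {k n} (G : Graph n) {c} → DegCond k G → Colourable G c → Δ G + 1 ≤ c + k
degCond-colourable {k} G {c} degCond col = decidable-stable (Δ G + 1 ≤? c + k) λ ¬bound →
  chromaticNumber-exists G c col λ (χ , isχ , χ≤c) → ¬bound (≤-trans (degCond χ isχ) (+-monoˡ-≤ k χ≤c))

upsilon⇒degCond : ∀ {k n} (G : Graph n) → Upsilon k G → 1 ≤ n → DegCond k G
upsilon⇒degCond {n = n} G upsilon 1≤n = upsilon n G 1≤n (induced-refl G)

pairedColours-size : ∀ {n c} (f : Fin n → Fin (suc c)) (v : Fin n) →
  (∀ t → ∃₂ λ a b → a ≢ b × f a ≡ punchIn (f v) t × f b ≡ punchIn (f v) t) →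
  suc (c + c) ≤ n
pairedColours-size {n} {c} f v pairs = injective⇒≤ embed-injective
  where
  first second : Fin c → Fin n
  first  t = proj₁ (pairs t)
  second t = proj₁ (proj₂ (pairs t))

  distinct : ∀ t → first t ≢ second t
  distinct t = proj₁ (proj₂ (proj₂ (pairs t)))

  -- the vertices other than v, indexed by (side, colour)
  pick : Fin c ⊎ Fin c → Fin n
  pick = [ first , second ]′

  colourIndex : Fin c ⊎ Fin c → Fin c
  colourIndex = [ id , id ]′

  pick-colour : ∀ x → f (pick x) ≡ punchIn (f v) (colourIndex x)
  pick-colour (inj₁ t) = proj₁ (proj₂ (proj₂ (proj₂ (pairs t))))
  pick-colour (inj₂ t) = proj₂ (proj₂ (proj₂ (proj₂ (pairs t))))

  pick-injective : ∀ x y → pick x ≡ pick y → x ≡ y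
  pick-injective x y same
    with punchIn-injective (f v) _ _ (trans (sym (pick-colour x)) (trans (cong f same) (pick-colour y)))
  pick-injective (inj₁ t) (inj₁ .t) same | refl = refl
  pick-injective (inj₂ t) (inj₂ .t) same | refl = refl
  pick-injective (inj₁ t) (inj₂ .t) same | refl = ⊥-elim (distinct t same)
  pick-injective (inj₂ t) (inj₁ .t) same | refl = ⊥-elim (distinct t (sym same))

  -- pick never hits v, whose colour is f v itself
  pick≢v : ∀ x → pick x ≢ v
  pick≢v x pick≡v = punchInᵢ≢i (f v) (colourIndex x) (trans (sym (pick-colour x)) (cong f pick≡v))

  embed : Fin (suc (c + c)) → Fin n
  embed zero    = v
  embed (suc i) = pick (splitAt c i)

  embed-injective : ∀ {i j} → embed i ≡ embed j → i ≡ j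
  embed-injective {zero}  {zero}  _    = refl
  embed-injective {zero}  {suc j} same = ⊥-elim (pick≢v (splitAt c j) (sym same))
  embed-injective {suc i} {zero}  same = ⊥-elim (pick≢v (splitAt c i) same)
  embed-injective {suc i} {suc j} same = cong suc (begin
    i                       ≡⟨ sym (join-splitAt c c i) ⟩
    join c c (splitAt c i)  ≡⟨ cong (join c c) (pick-injective (splitAt c i) (splitAt c j) same) ⟩
    join c c (splitAt c j)  ≡⟨ join-splitAt c c j ⟩
    j                       ∎)
    where open ≡-Reasoning

doubled-bound : ∀ c k m → c + c ≤ m → m ≤ suc c + k → m ≤ 2 + (k + k)
doubled-bound c k m 2c≤m m≤1+c+k = ≤-trans m≤1+c+k (+-monoˡ-≤ k (s≤s c≤1+k))
  where
  c≤1+k : c ≤ suc k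
  c≤1+k = +-cancelˡ-≤ c _ _ (≤-trans 2c≤m (≤-trans m≤1+c+k (≤-reflexive (sym (+-suc c k)))))

-- A critical configuration: H has 1+m vertices and chromatic number 1+c₀ (witnessed by
-- the colouring f and the failure of c₀ colours), violates Δ(H) ≤ χ(H)+k-1, while every
-- vertex-deleted subgraph satisfies the degree condition.
module CriticalGraph {k m c₀ : ℕ} (H : Graph (suc m))
  (f : Fin (suc m) → Fin (suc c₀)) (proper : ∀ i j → adj H i j ≡ true → f i ≢ f j)
  (minimal : ¬ Colourable H c₀) (excess : suc c₀ + k ≤ Δ H)
  (deletions : ∀ u → DegCond k (delete H u)) where

  centre : Fin (suc m)
  centre = proj₁ (Δ-attained H)

  centre-deg : deg H centre ≡ Δ H
  centre-deg = proj₂ (Δ-attained H)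

  -- every H - u is still (1+c₀)-colourable, so its maximum degree is below 1+c₀+k ≤ Δ(H)
  deleted-Δ : ∀ u → Δ (delete H u) + 1 ≤ suc c₀ + k
  deleted-Δ u = degCond-colourable (delete H u) (deletions u) (restrict {A = delete H u} {B = H} (delete-induced H u) (f , proper))

  Δ-step : ∀ {u} → u ≢ centre → Δ H ≤ Δ (delete H u) + 1
  Δ-step {u} u≢centre = begin
    Δ H                                             ≤⟨ Δ-delete H centre-deg u≢centre ⟩
    indicator (adj H centre u) + Δ (delete H u)     ≤⟨ +-monoˡ-≤ _ (indicator≤1 (adj H centre u)) ⟩
    1 + Δ (delete H u)                              ≡⟨ +-comm 1 _ ⟩
    Δ (delete H u) + 1                              ∎
    where open ≤-Reasoning

  -- (1) the centre is adjacent to every other vertex, otherwise Δ(H) ≤ Δ(H - u)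
  centre-universal : ∀ u → u ≢ centre → adj H centre u ≡ true
  centre-universal u u≢centre with adj H centre u | Δ-delete H centre-deg u≢centre
  ... | true  | _       = refl
  ... | false | Δ≤Δ-u   =
    ⊥-elim (m+1+n≰m (Δ (delete H u)) (≤-trans (deleted-Δ u) (≤-trans excess Δ≤Δ-u)))

  m≡Δ : m ≡ Δ H
  m≡Δ = trans (sym (deg-universal H centre centre-universal)) centre-deg

  -- H has a vertex besides the centre, since Δ(H) ≥ 1
  other : Fin (suc m)
  other = punchIn centre (fromℕ< (subst (1 ≤_) (sym m≡Δ) (≤-trans (s≤s z≤n) excess)))

  m≤colours : m ≤ suc c₀ + k
  m≤colours = begin
    m                           ≡⟨ m≡Δ ⟩
    Δ H                         ≤⟨ Δ-step (punchInᵢ≢i centre _) ⟩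
    Δ (delete H other) + 1      ≤⟨ deleted-Δ other ⟩
    suc c₀ + k                  ∎
    where open ≤-Reasoning

  -- (3) a vertex u ≠ centre alone in its colour class would make H - u c₀-colourable,
  -- giving Δ(H) ≤ Δ(H - u) + 1 ≤ c₀+k
  colour-shared : ∀ u → u ≢ centre → ∃[ w ] w ≢ u × f w ≡ f u
  colour-shared u u≢centre =
    decidable-stable (any? λ w → ¬? (w ≟ u) ×-dec (f w ≟ f u)) λ alone →
      1+n≰n (≤-trans excess (≤-trans (Δ-step u≢centre)
        (degCond-colourable (delete H u) (deletions u) (reducedColouring alone))))
    where
    reducedColouring : ¬ (∃[ w ] w ≢ u × f w ≡ f u) → Colourable (delete H u) c₀
    reducedColouring alone = dropColour (delete H u) (f ∘ punchIn u) (λ i j → proper _ _) (f u)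
      λ i fu≡fi → alone (punchIn u i , punchInᵢ≢i u i , sym fu≡fi)

  -- by minimality of 1+c₀, every colour is used
  colour-used : ∀ x → ∃[ w ] f w ≡ x
  colour-used x = decidable-stable (any? λ w → f w ≟ x) λ unused →
    minimal (dropColour H f proper x λ w x≡fw → unused (w , sym x≡fw))

  colour-pairs : ∀ t → ∃₂ λ a b → a ≢ b × f a ≡ punchIn (f centre) t × f b ≡ punchIn (f centre) t
  colour-pairs t with colour-used (punchIn (f centre) t)
  ... | a , fa≡t with colour-shared a (λ a≡centre → punchInᵢ≢i (f centre) t (trans (sym fa≡t) (cong f a≡centre)))
  ...   | b , b≢a , fb≡fa = a , b , (λ a≡b → b≢a (sym a≡b)) , fa≡t , trans fb≡fa fa≡t

  size : suc m ≤ 3 + (k + k)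
  size = s≤s (doubled-bound c₀ k m (≤-pred (pairedColours-size f centre colour-pairs)) m≤colours)

-- A graph with more than 2k+3 vertices all of whose vertex-deleted subgraphs satisfy the
-- degree condition satisfies it as well: a violation would be a critical configuration.
degCond-large : ∀ k {m} (H : Graph (suc m)) → 3 + (k + k) < suc m →
  (∀ u → DegCond k (delete H u)) → DegCond k H
degCond-large k H large deletions zero ((f , _) , _) = ⊥-elim (¬Fin0 (f zero))
degCond-large k H large deletions (suc c₀) ((f , proper) , minimal) with Δ H + 1 ≤? suc c₀ + k
... | yes bound   = bound
... | no ¬bound   = ⊥-elim (<⇒≱ large (CriticalGraph.size H f proper (minimal c₀ ≤-refl) excess deletions))
  where
  excess : suc c₀ + k ≤ Δ H
  excess = +-cancelʳ-≤ 1 (suc c₀ + k) (Δ H) (subst (_≤ Δ H + 1) (+-comm 1 (suc c₀ + k)) (≰⇒> ¬bound))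

-- Every minimal forbidden induced subgraph of Υ_k has at most 2k+3 vertices: otherwise
-- all its induced subgraphs, proper ones by minimality and large ones by degCond-large,
-- would satisfy the degree condition, i.e. it would lie in Υ_k.
minimalForbidden-size : ∀ k {n} (F : Graph n) → MinForbidden k F → n ≤ 3 + (k + k)
minimalForbidden-size k {n} F (notUpsilon , minimal) with n ≤? 3 + (k + k)
... | yes small = small
... | no large  = ⊥-elim (notUpsilon upsilon)
  where
  upsilon : Upsilon k F
  upsilon zero    H () _
  upsilon (suc m) H 1≤m H⊆F with suc m <? n
  ... | yes proper = upsilon⇒degCond H (minimal (suc m) H proper H⊆F) 1≤m
  ... | no ¬proper = degCond-large k H H-large λ u →
    upsilon⇒degCond (delete H u) (minimal m (delete H u) (induced-size {H = H} {G = F} H⊆F)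
                       (induced-trans {A = delete H u} {B = H} {C = F} (delete-induced H u) H⊆F))
                    (≤-trans (s≤s z≤n) (≤-pred H-large))
    where
    H-large : 3 + (k + k) < suc m
    H-large = <-≤-trans (≰⇒> large) (≮⇒≥ ¬proper)

SameAdjacency : ∀ {n} → Graph n → Graph n → Set
SameAdjacency F G = ∀ i j → adj F i j ≡ adj G i j

sameAdjacency⇒iso : ∀ {n} {F G : Graph n} → SameAdjacency F G → Iso F G
sameAdjacency⇒iso {n} same = ↔-id (Fin n) , same

vectors : ∀ {A : Set} → List A → ∀ n → List (Vector A n)
vectors xs zero    = (λ ()) ∷ []
vectors xs (suc n) = cartesianProductWith Vector._∷_ xs (vectors xs n)

vectors-complete : ∀ {A : Set} {xs : List A} → (∀ x → Any (_≡ x) xs) →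
  ∀ n (g : Vector A n) → Any (λ h → ∀ i → h i ≡ g i) (vectors xs n)
vectors-complete complete zero    g = here (λ ())
vectors-complete complete (suc n) g =
  cartesianProductWith⁺ Vector._∷_ cons-agrees (complete (g zero)) (vectors-complete complete n (g ∘ suc))
  where
  cons-agrees : ∀ {x h} → x ≡ g zero → (∀ i → h i ≡ g (suc i)) → ∀ i → (x Vector.∷ h) i ≡ g i
  cons-agrees x≡ h≡ zero    = x≡
  cons-agrees x≡ h≡ (suc i) = h≡ i

bools : List Bool
bools = true ∷ false ∷ []

bools-complete : ∀ b → Any (_≡ b) bools
bools-complete true  = here refl
bools-complete false = there (here refl)

extend : ∀ {n} → Graph n → Vector Bool n → Graph (suc n)
extend G N = record { adj = adjacency ; sym = symmetric ; irrefl = irreflexive }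
  where
  adjacency : Fin _ → Fin _ → Bool
  adjacency zero    zero    = false
  adjacency zero    (suc j) = N j
  adjacency (suc i) zero    = N i
  adjacency (suc i) (suc j) = adj G i j

  symmetric : ∀ i j → adjacency i j ≡ adjacency j i
  symmetric zero    zero    = refl
  symmetric zero    (suc j) = refl
  symmetric (suc i) zero    = refl
  symmetric (suc i) (suc j) = Graph.sym G i j

  irreflexive : ∀ i → adjacency i i ≡ false
  irreflexive zero    = refl
  irreflexive (suc i) = irrefl G i

emptyGraph : Graph 0
emptyGraph = record { adj = λ () ; sym = λ () ; irrefl = λ () }

graphsOfOrder : ∀ n → List (Graph n)
graphsOfOrder zero    = emptyGraph ∷ []
graphsOfOrder (suc n) = cartesianProductWith extend (graphsOfOrder n) (vectors bools n)

-- Every graph on Fin (1+n) is `extend` of G - 0 by the neighbourhood of 0.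
graphsOfOrder-complete : ∀ n (F : Graph n) → Any (SameAdjacency F) (graphsOfOrder n)
graphsOfOrder-complete zero    F = here (λ ())
graphsOfOrder-complete (suc n) F =
  cartesianProductWith⁺ extend extend-agrees
    (graphsOfOrder-complete n (delete F zero)) (vectors-complete bools-complete n (adj F zero ∘ suc))
  where
  extend-agrees : ∀ {G N} → SameAdjacency (delete F zero) G → (∀ i → N i ≡ adj F zero (suc i)) →
    SameAdjacency F (extend G N)
  extend-agrees G≡ N≡ zero    zero    = irrefl F zero
  extend-agrees G≡ N≡ zero    (suc j) = sym (N≡ j)
  extend-agrees G≡ N≡ (suc i) zero    = trans (Graph.sym F (suc i) zero) (sym (N≡ i))
  extend-agrees G≡ N≡ (suc i) (suc j) = G≡ i j

graphsBelow : ℕ → List SomeGraph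
graphsBelow zero    = []
graphsBelow (suc N) = map (N ,_) (graphsOfOrder N) ++ graphsBelow N

graphsBelow-complete : ∀ N {n} → n < N → (F : Graph n) → Any (λ G → Iso F (proj₂ G)) (graphsBelow N)
graphsBelow-complete (suc N) n<1+N F with m≤n⇒m<n∨m≡n (≤-pred n<1+N)
... | inj₁ n<N = ++⁺ʳ _ (graphsBelow-complete N n<N F)
... | inj₂ refl = ++⁺ˡ (map⁺ (Any.map (λ {G} → sameAdjacency⇒iso {F = F} {G}) (graphsOfOrder-complete N F)))

mainTheorem4 : (k : ℕ) → ∃[ L ] (∀ n (F : Graph n) → MinForbidden k F →
                 Any (λ (G : SomeGraph) → Iso F (proj₂ G)) L)
mainTheorem4 k = graphsBelow (4 + (k + k)) , λ n F minimalForbidden →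
  graphsBelow-complete (4 + (k + k)) (s≤s (minimalForbidden-size k F minimalForbidden)) F
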